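{- Let $P$ be a finite ranked poset of rank $2$ that is sufficiently covered. If $\bar R_1>0$, then $\chi_{gr}(P)>0$.
   Context: For a poset $P$, write $a \prec b$ if $b$ covers $a$. A rank function for $P$ is a function $\rho: P \to \{0,1,\dots,r\}$ such that $\rho(a)=0$ for every minimal element $a$, and $\rho(b)=\rho(a)+1$ whenever $a \prec b$. $P$ is ranked if it has a rank function; its rank is the smallest possible such $r$. For $i$ let $P_i=\{x\in P\mid\rho(x)=i\}$ and $p_i=|P_i|$. The ranked Euler characteristic of a finite ranked poset of rank $r$ is $\chi_{gr}(P)=\sum_{i=0}^r(-1)^ip_i$. For $x\in P_i$: $A_i(x)=|\{y\in P_{i+1}\mid x\prec y\}|$, $B_i(x)=|\{z\in P_{i-1}\mid z\prec x\}|$, $U_i(x)=\sum_{y\succ x}B_{i+1}(y)$, $D_i(x)=\sum_{z\prec x}A_{i-1}(z)$. For rank $2$, $R_1(e)=1+6A_1(e)+\tfrac32B_1(e)-U_1(e)-D_1(e)$ for $e\in P_1$. Define the averages $\bar R_1=\frac1{p_1}\sum_{e\in P_1}R_1(e)$, $\bar A_1=\frac1{p_1}\sum_{e\in P_1}A_1(e)$, $\bar B_1=\frac1{p_1}\sum_{e\in P_1}B_1(e)$. $P$ is sufficiently covered if $(\bar A_1+\bar B_1)^2-6\bar A_1-\tfrac32\bar B_1-1\ge0$. -}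

module Defs where

open import Data.Nat as ℕ using (ℕ; zero; suc)
open import Data.Fin using (Fin) renaming (_≟_ to _≟ᶠ_)
open import Data.Fin.Properties using (all?)
open import Data.List using (List; []; _∷_; length; filter; map; foldr; upTo; allFin)

open import Data.Integer as ℤ using (ℤ; +_)
open import Data.Rational as ℚ using (ℚ; 0ℚ; 1ℚ; _/_)
open import Data.Product using (Σ; ∃; _×_; _,_)
open import Data.Sum using (_⊎_)
open import Relation.Nullary using (¬_; Dec)
open import Relation.Nullary.Decidable using (_×-dec_; _⊎-dec_; _→-dec_; ¬?)
open import Relation.Binary.PropositionalEquality using (_≡_; _≢_)
open import Relation.Binary.Structures using (IsDecPartialOrder)


record FinitePoset : Set₁ where
  field
    size  : ℕ
    _≤_   : Fin size → Fin size → Set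
    isDecPartialOrder : IsDecPartialOrder _≡_ _≤_
  open IsDecPartialOrder isDecPartialOrder public using (_≤?_)

module _ (P : FinitePoset) where
  open FinitePoset P

  Elt : Set
  Elt = Fin size

  elts : List Elt
  elts = allFin size

  _⋖_ : Elt → Elt → Set
  a ⋖ b = (a ≤ b) × (a ≢ b) × (∀ c → a ≤ c → c ≤ b → (c ≡ a ⊎ c ≡ b))

  _⋖?_ : ∀ a b → Dec (a ⋖ b)
  a ⋖? b = (a ≤? b) ×-dec (¬? (a ≟ᶠ b)) ×-dec
           all? (λ c → (a ≤? c) →-dec ((c ≤? b) →-dec ((c ≟ᶠ a) ⊎-dec (c ≟ᶠ b))))

  Minimal : Elt → Set
  Minimal a = ∀ b → b ≤ a → b ≡ a

  IsRankFunction : (Elt → ℕ) → ℕ → Set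
  IsRankFunction ρ r =
      (∀ x → ρ x ℕ.≤ r)
    × (∀ a → Minimal a → ρ a ≡ 0)
    × (∀ a b → a ⋖ b → ρ b ≡ suc (ρ a))

  Ranked : ℕ → Set
  Ranked r = ∃ λ ρ → IsRankFunction ρ r

  HasRank : ℕ → Set
  HasRank r = Ranked r × (∀ r' → Ranked r' → r ℕ.≤ r')

  module WithRank (ρ : Elt → ℕ) where

    level : ℕ → List Elt
    level i = filter (λ x → ρ x ℕ.≟ i) elts

    p : ℕ → ℕ
    p i = length (level i)

    χgr : ℕ → ℤ
    χgr r = foldr (λ i acc → sgn i ℤ.* (+ p i) ℤ.+ acc) (+ 0) (upTo (suc r))
      where
      sgn : ℕ → ℤ
      sgn i = (ℤ.- ℤ.1ℤ) ℤ.^ i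

    A : ℕ → Elt → ℕ
    A i x = length (filter (λ y → x ⋖? y) (level (suc i)))

    B : ℕ → Elt → ℕ
    B zero    x = 0
    B (suc i) x = length (filter (λ z → z ⋖? x) (level i))

    sumℕ : List ℕ → ℕ
    sumℕ = foldr ℕ._+_ 0

    U : ℕ → Elt → ℕ
    U i x = sumℕ (map (B (suc i)) (filter (λ y → x ⋖? y) elts))

    D : ℕ → Elt → ℕ
    D zero    x = 0
    D (suc i) x = sumℕ (map (A i) (filter (λ z → z ⋖? x) elts))

    ℕ→ℚ : ℕ → ℚ
    ℕ→ℚ k = (+ k) / 1

    R₁ : Elt → ℚ
    R₁ e = 1ℚ ℚ.+ ℕ→ℚ 6 ℚ.* ℕ→ℚ (A 1 e) ℚ.+ ((+ 3) / 2) ℚ.* ℕ→ℚ (B 1 e)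
             ℚ.- ℕ→ℚ (U 1 e) ℚ.- ℕ→ℚ (D 1 e)

    -- average of a function over P_1 (convention: 0 if P_1 is empty,
    -- which never happens for rank 2)
    avg₁ : (Elt → ℚ) → ℚ
    avg₁ f with level 1
    ... | []     = 0ℚ
    ... | x ∷ xs = foldr ℚ._+_ 0ℚ (map f (x ∷ xs)) ℚ.* ((+ 1) / suc (length xs))

    R̄₁ Ā₁ B̄₁ : ℚ
    R̄₁ = avg₁ R₁
    Ā₁ = avg₁ (λ e → ℕ→ℚ (A 1 e))
    B̄₁ = avg₁ (λ e → ℕ→ℚ (B 1 e))

    SufficientlyCovered : Set
    SufficientlyCovered =
      0ℚ ℚ.≤ (Ā₁ ℚ.+ B̄₁) ℚ.* (Ā₁ ℚ.+ B̄₁) ℚ.- ℕ→ℚ 6 ℚ.* Ā₁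
               ℚ.- ((+ 3) / 2) ℚ.* B̄₁ ℚ.- 1ℚ

-- Write N = p₁ and let F = ΣA₁ and E = ΣB₁ count the cover relations between ranks 1 and 2
-- and between ranks 0 and 1. Double counting gives F = Σ_{y ∈ P₂} B₂(y), E = Σ_{z ∈ P₀} A₀(z),
-- ΣU₁ = Σ_{y ∈ P₂} B₂(y)² and ΣD₁ = Σ_{z ∈ P₀} A₀(z)², so Cauchy–Schwarz over the p₀ + p₂
-- elements of P₀ ∪ P₂ gives (F + E)² ≤ (p₀ + p₂)(ΣU₁ + ΣD₁). Clearing the denominators of the
-- averages, R̄₁ > 0 says 2ΣU₁ + 2ΣD₁ < 2N + 12F + 3E, and sufficient covering says
-- N(2N + 12F + 3E) ≤ 2(F + E)². If p₀ + p₂ ≤ N these chain to the contradiction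
-- 2(F + E)² ≤ N(2ΣU₁ + 2ΣD₁) < N(2N + 12F + 3E) ≤ 2(F + E)²,
-- so p₁ < p₀ + p₂, that is, χ = p₀ − p₁ + p₂ > 0.

module Submission where

open import Defs
open import Data.Nat using (ℕ)
open import Data.Integer using (+_) renaming (_<_ to _<ℤ_)
open import Data.Rational using (0ℚ) renaming (_<_ to _<ℚ_)

open import Data.Bool.Base using (if_then_else_; true; false)
open import Data.Integer.Base as ℤ using (_⊖_)
import Data.Integer.Properties as ℤ
open import Data.Integer.Tactic.RingSolver renaming (solve-∀ to ℤ-solve-∀)
open import Data.List.Base using (List; []; _∷_; _++_; length; map; filter; foldr)
open import Data.List.Properties using (map-cong; map-++; map-∘; length-map; length-++)
open import Data.Nat.Base using (suc; _+_; _*_; _≤_; _<_; NonZero)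
open import Data.Nat.Coprimality using (1-coprimeTo) renaming (sym to coprime-sym)
open import Data.Nat.ListAction using (sum)
open import Data.Nat.ListAction.Properties using (sum-++)
open import Data.Nat.Properties
open import Data.Nat.Tactic.RingSolver using (solve-∀)
open import Data.Product.Base using (_,_)
open import Data.Rational.Base as ℚ using (ℚ; mkℚ; 1ℚ; _/_; NonNegative; Positive)
import Data.Rational.Properties as ℚ
open import Data.Rational.Unnormalised.Base using (*≡*)
import Data.Rational.Unnormalised.Properties as ℚᵘ
open import Data.Sum.Base using ([_,_]′)
open import Level using (Level; 0ℓ)
open import Relation.Binary.PropositionalEquality
open import Relation.Nullary using (Dec; does; contradiction)
open import Relation.Nullary.Decidable.Core using (dec⇒maybe)
open import Relation.Unary using (Pred; Decidable)
import Tactic.RingSolver as ℚ-Solver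
open import Tactic.RingSolver.Core.AlmostCommutativeRing using (AlmostCommutativeRing; fromCommutativeRing)

private variable
  a b ℓ : Level
  X : Set a
  Y : Set b

sum-map-const : ∀ c (xs : List X) → sum (map (λ _ → c) xs) ≡ c * length xs
sum-map-const c []       = sym (*-zeroʳ c)
sum-map-const c (x ∷ xs) = trans (cong (_+_ c) (sum-map-const c xs)) (sym (*-suc c (length xs)))

sum-map-+ : ∀ (f g : X → ℕ) xs → sum (map (λ x → f x + g x) xs) ≡ sum (map f xs) + sum (map g xs)
sum-map-+ f g []       = refl
sum-map-+ f g (x ∷ xs) = trans (cong (_+_ (f x + g x)) (sum-map-+ f g xs))
                               (+-+-exchange (f x) (g x) _ _)
  where
  +-+-exchange : ∀ m n o p → m + n + (o + p) ≡ m + o + (n + p)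
  +-+-exchange = solve-∀

module _ {P : Pred X ℓ} (P? : Decidable P) where

  sum-map-filter-≤ : ∀ (f : X → ℕ) xs → sum (map f (filter P? xs)) ≤ sum (map f xs)
  sum-map-filter-≤ f []       = ≤-refl
  sum-map-filter-≤ f (x ∷ xs) with does (P? x)
  ... | true  = +-monoʳ-≤ (f x) (sum-map-filter-≤ f xs)
  ... | false = ≤-trans (sum-map-filter-≤ f xs) (m≤n+m _ (f x))

  sum-map-filter-∷ : ∀ (f : X → ℕ) x xs →
    sum (map f (filter P? (x ∷ xs))) ≡ (if does (P? x) then f x else 0) + sum (map f (filter P? xs))
  sum-map-filter-∷ f x xs with does (P? x)
  ... | true  = refl
  ... | false = refl

  sum-map-if : ∀ c xs → sum (map (λ x → if does (P? x) then c else 0) xs) ≡ c * length (filter P? xs)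
  sum-map-if c []       = sym (*-zeroʳ c)
  sum-map-if c (x ∷ xs) with does (P? x)
  ... | true  = trans (cong (_+_ c) (sum-map-if c xs)) (sym (*-suc c _))
  ... | false = sum-map-if c xs

module _ {R : X → Y → Set ℓ} (R? : ∀ x y → Dec (R x y)) where

  sum-map-sum-filter : ∀ (g : Y → ℕ) xs ys →
    sum (map (λ x → sum (map g (filter (R? x) ys))) xs) ≡
    sum (map (λ y → g y * length (filter (λ x → R? x y) xs)) ys)
  sum-map-sum-filter g xs []       = sum-map-const 0 xs
  sum-map-sum-filter g xs (y ∷ ys) = begin
    sum (map (λ x → sum (map g (filter (R? x) (y ∷ ys)))) xs)
      ≡⟨ cong sum (map-cong (λ x → sum-map-filter-∷ (R? x) g y ys) xs) ⟩
    sum (map (λ x → (if does (R? x y) then g y else 0) + sum (map g (filter (R? x) ys))) xs)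
      ≡⟨ sum-map-+ _ _ xs ⟩
    sum (map (λ x → if does (R? x y) then g y else 0) xs) + sum (map (λ x → sum (map g (filter (R? x) ys))) xs)
      ≡⟨ cong₂ _+_ (sum-map-if (λ x → R? x y) (g y) xs) (sum-map-sum-filter g xs ys) ⟩
    g y * length (filter (λ x → R? x y) xs) + sum (map (λ y → g y * length (filter (λ x → R? x y) xs)) ys)
      ∎
    where open ≡-Reasoning

  sum-map-length-filter : ∀ xs ys →
    sum (map (λ x → length (filter (R? x) ys)) xs) ≡ sum (map (λ y → length (filter (λ x → R? x y) xs)) ys)
  sum-map-length-filter xs ys = begin
    sum (map (λ x → length (filter (R? x) ys)) xs)
      ≡⟨ cong sum (map-cong (λ x → sym (length≡sum-map-1 (filter (R? x) ys))) xs) ⟩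
    sum (map (λ x → sum (map (λ _ → 1) (filter (R? x) ys))) xs)
      ≡⟨ sum-map-sum-filter (λ _ → 1) xs ys ⟩
    sum (map (λ y → 1 * length (filter (λ x → R? x y) xs)) ys)
      ≡⟨ cong sum (map-cong (λ y → *-identityˡ _) ys) ⟩
    sum (map (λ y → length (filter (λ x → R? x y) xs)) ys)
      ∎
    where
    open ≡-Reasoning
    length≡sum-map-1 : ∀ (zs : List Y) → sum (map (λ _ → 1) zs) ≡ length zs
    length≡sum-map-1 zs = trans (sum-map-const 1 zs) (*-identityˡ _)

2*[m*n]≤m*m+n*n : ∀ m n → 2 * (m * n) ≤ m * m + n * n
2*[m*n]≤m*m+n*n m n = [ ordered , swapped ]′ (≤-total m n)
  where
  ordered : ∀ {m n} → m ≤ n → 2 * (m * n) ≤ m * m + n * n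
  ordered {m} m≤n with k , refl ← m≤n⇒∃[o]m+o≡n m≤n =
    ≤-trans (m≤m+n _ (k * k)) (≤-reflexive (square-gap m k))
    where
    square-gap : ∀ m k → 2 * (m * (m + k)) + k * k ≡ m * m + (m + k) * (m + k)
    square-gap = solve-∀
  swapped : n ≤ m → 2 * (m * n) ≤ m * m + n * n
  swapped n≤m = subst₂ _≤_ (cong (2 *_) (*-comm n m)) (+-comm (n * n) (m * m)) (ordered n≤m)

cauchy-schwarz : ∀ ns → sum ns * sum ns ≤ length ns * sum (map (λ n → n * n) ns)
cauchy-schwarz []       = ≤-refl
cauchy-schwarz (m ∷ ns) = begin
  (m + s) * (m + s)                  ≡⟨ expand m s ⟩
  m * m + 2 * (m * s) + s * s        ≤⟨ +-mono-≤ (+-monoʳ-≤ (m * m) (cross-term m ns)) (cauchy-schwarz ns) ⟩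
  m * m + (q + k * (m * m)) + k * q  ≡⟨ regroup m q k ⟩
  suc k * (m * m + q)                ∎
  where
  open ≤-Reasoning
  s q k : ℕ
  s = sum ns
  q = sum (map (λ n → n * n) ns)
  k = length ns
  expand : ∀ m s → (m + s) * (m + s) ≡ m * m + 2 * (m * s) + s * s
  expand = solve-∀
  regroup : ∀ m q k → m * m + (q + k * (m * m)) + k * q ≡ suc k * (m * m + q)
  regroup = solve-∀
  cross-term : ∀ m ns → 2 * (m * sum ns) ≤ sum (map (λ n → n * n) ns) + length ns * (m * m)
  cross-term m []       = ≤-reflexive (cong (2 *_) (*-zeroʳ m))
  cross-term m (n ∷ ns) = begin
    2 * (m * (n + sum ns))
      ≡⟨ split m n (sum ns) ⟩
    2 * (n * m) + 2 * (m * sum ns)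
      ≤⟨ +-mono-≤ (2*[m*n]≤m*m+n*n n m) (cross-term m ns) ⟩
    n * n + m * m + (sum (map (λ n → n * n) ns) + length ns * (m * m))
      ≡⟨ collect (n * n) (m * m) _ (length ns) ⟩
    n * n + sum (map (λ n → n * n) ns) + suc (length ns) * (m * m)
      ∎
    where
    split : ∀ m n s → 2 * (m * (n + s)) ≡ 2 * (n * m) + 2 * (m * s)
    split = solve-∀
    collect : ∀ a b q k → a + b + (q + k * b) ≡ a + q + suc k * b
    collect = solve-∀

<-of-covering-bounds : ∀ n {f e u d k} .{{_ : NonZero n}} →
  2 * u + 2 * d < 2 * n + 12 * f + 3 * e →
  n * (2 * n + 12 * f + 3 * e) ≤ 2 * ((f + e) * (f + e)) →
  (f + e) * (f + e) ≤ k * (u + d) →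
  n < k
<-of-covering-bounds n {f} {e} {u} {d} {k} R-bound cover-bound cs-bound =
  ≰⇒> λ k≤n → <-irrefl refl (begin-strict
  2 * ((f + e) * (f + e))       ≤⟨ *-monoʳ-≤ 2 cs-bound ⟩
  2 * (k * (u + d))             ≤⟨ *-monoʳ-≤ 2 (*-monoˡ-≤ (u + d) k≤n) ⟩
  2 * (n * (u + d))             ≡⟨ distribute n u d ⟩
  n * (2 * u + 2 * d)           <⟨ *-monoʳ-< n R-bound ⟩
  n * (2 * n + 12 * f + 3 * e)  ≤⟨ cover-bound ⟩
  2 * ((f + e) * (f + e))       ∎)
  where
  open ≤-Reasoning
  distribute : ∀ n u d → 2 * (n * (u + d)) ≡ n * (2 * u + 2 * d)
  distribute = solve-∀

n<m⇒0<m⊖n : ∀ {m n} → n < m → + 0 <ℤ m ⊖ n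
n<m⇒0<m⊖n {m} {n} n<m = subst (_<ℤ m ⊖ n) (ℤ.n⊖n≡0 m) (ℤ.⊖-monoʳ->-< m n<m)

ℚ-ring : AlmostCommutativeRing 0ℓ 0ℓ
ℚ-ring = fromCommutativeRing ℚ.+-*-commutativeRing (λ x → dec⇒maybe (0ℚ ℚ.≟ x))

-- Definitionally equal to WithRank.ℕ→ℚ, so the lemmas below apply directly to R₁ and the averages.
toℚ : ℕ → ℚ
toℚ n = + n / 1

private
  ι : ℕ → ℚ
  ι n = mkℚ (+ n) 0 (coprime-sym (1-coprimeTo n))

  toℚ≡ι : ∀ n → toℚ n ≡ ι n
  toℚ≡ι n = ℚ.↥p/↧p≡p (ι n)

toℚ-+ : ∀ m n → toℚ (m + n) ≡ toℚ m ℚ.+ toℚ n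
toℚ-+ m n rewrite toℚ≡ι (m + n) | toℚ≡ι m | toℚ≡ι n =
  ℚ.toℚᵘ-injective (ℚᵘ.≃-sym (ℚᵘ.≃-trans (ℚ.toℚᵘ-homo-+ (ι m) (ι n)) (*≡* (cross (+ m) (+ n)))))
  where
  cross : ∀ i j → (i ℤ.* + 1 ℤ.+ j ℤ.* + 1) ℤ.* + 1 ≡ (i ℤ.+ j) ℤ.* (+ 1 ℤ.* + 1)
  cross = ℤ-solve-∀

toℚ-* : ∀ m n → toℚ (m * n) ≡ toℚ m ℚ.* toℚ n
toℚ-* m n rewrite toℚ≡ι (m * n) | toℚ≡ι m | toℚ≡ι n =
  ℚ.toℚᵘ-injective (ℚᵘ.≃-sym (ℚᵘ.≃-trans (ℚ.toℚᵘ-homo-* (ι m) (ι n))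
                                          (*≡* (cong (ℤ._* + 1) (sym (ℤ.pos-* m n))))))

toℚ-linear₂ : ∀ i x j y → toℚ (i * x + j * y) ≡ toℚ i ℚ.* toℚ x ℚ.+ toℚ j ℚ.* toℚ y
toℚ-linear₂ i x j y = trans (toℚ-+ (i * x) (j * y)) (cong₂ ℚ._+_ (toℚ-* i x) (toℚ-* j y))

toℚ-linear₃ : ∀ i x j y k z →
  toℚ (i * x + j * y + k * z) ≡ toℚ i ℚ.* toℚ x ℚ.+ toℚ j ℚ.* toℚ y ℚ.+ toℚ k ℚ.* toℚ z
toℚ-linear₃ i x j y k z =
  trans (toℚ-+ (i * x + j * y) (k * z)) (cong₂ ℚ._+_ (toℚ-linear₂ i x j y) (toℚ-* k z))

toℚ-sum : ∀ (g : X → ℕ) xs → foldr ℚ._+_ 0ℚ (map (λ x → toℚ (g x)) xs) ≡ toℚ (sum (map g xs))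
toℚ-sum g []       = refl
toℚ-sum g (x ∷ xs) = trans (cong (toℚ (g x) ℚ.+_) (toℚ-sum g xs)) (sym (toℚ-+ (g x) (sum (map g xs))))

toℚ-cancel-< : ∀ {m n} → toℚ m ℚ.< toℚ n → m < n
toℚ-cancel-< {m} {n} m<n = ℤ.drop‿+<+ (subst₂ ℤ._<_ (ℤ.*-identityʳ (+ m)) (ℤ.*-identityʳ (+ n))
  (ℚ.drop-*<* (subst₂ ℚ._<_ (toℚ≡ι m) (toℚ≡ι n) m<n)))

toℚ-cancel-≤ : ∀ {m n} → toℚ m ℚ.≤ toℚ n → m ≤ n
toℚ-cancel-≤ {m} {n} m≤n = ℤ.drop‿+≤+ (subst₂ ℤ._≤_ (ℤ.*-identityʳ (+ m)) (ℤ.*-identityʳ (+ n))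
  (ℚ.drop-*≤* (subst₂ ℚ._≤_ (toℚ≡ι m) (toℚ≡ι n) m≤n)))

toℚ-nonNeg : ∀ n → NonNegative (toℚ n)
toℚ-nonNeg n = ℚ.normalize-nonNeg n 1

toℚ-pos : ∀ n .{{_ : NonZero n}} → Positive (toℚ n)
toℚ-pos n = ℚ.normalize-pos n 1

1/[1+m]*toℚ[1+m]≡1 : ∀ m → + 1 / suc m ℚ.* toℚ (suc m) ≡ 1ℚ
1/[1+m]*toℚ[1+m]≡1 m =
  trans (cong₂ ℚ._*_ (ℚ.↥p/↧p≡p (ℚ.1/ ι (suc m))) (toℚ≡ι (suc m))) (ℚ.*-inverseˡ (ι (suc m)))

0<p-q⇒q<p : ∀ {p q} → 0ℚ ℚ.< p ℚ.- q → q ℚ.< p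
0<p-q⇒q<p {p} {q} 0<p-q = subst₂ ℚ._<_ (ℚ.+-identityˡ q) (cancel p q) (ℚ.+-monoˡ-< q 0<p-q)
  where
  cancel : ∀ p q → p ℚ.- q ℚ.+ q ≡ p
  cancel = ℚ-Solver.solve-∀ ℚ-ring

0≤p-q⇒q≤p : ∀ {p q} → 0ℚ ℚ.≤ p ℚ.- q → q ℚ.≤ p
0≤p-q⇒q≤p {p} {q} 0≤p-q = subst₂ ℚ._≤_ (ℚ.+-identityˡ q) (cancel p q) (ℚ.+-monoˡ-≤ q 0≤p-q)
  where
  cancel : ∀ p q → p ℚ.- q ℚ.+ q ≡ p
  cancel = ℚ-Solver.solve-∀ ℚ-ring

private
  R-formℚ : ℚ → ℚ → ℚ → ℚ → ℚ → ℚ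
  R-formℚ n a b u d = n ℚ.+ toℚ 6 ℚ.* a ℚ.+ (+ 3 / 2) ℚ.* b ℚ.- u ℚ.- d

  R-formℚ-cong : ∀ {n a b u d n′ a′ b′ u′ d′} → n ≡ n′ → a ≡ a′ → b ≡ b′ → u ≡ u′ → d ≡ d′ →
                 R-formℚ n a b u d ≡ R-formℚ n′ a′ b′ u′ d′
  R-formℚ-cong refl refl refl refl refl = refl

-- R₁ e is R-form 1 (A 1 e) (B 1 e) (U 1 e) (D 1 e); summed over P₁ it becomes R-form p₁ ΣA₁ ΣB₁ ΣU₁ ΣD₁.
R-form : ℕ → ℕ → ℕ → ℕ → ℕ → ℚ
R-form n a b u d = R-formℚ (toℚ n) (toℚ a) (toℚ b) (toℚ u) (toℚ d)

R-form-+ : ∀ n a b u d n′ a′ b′ u′ d′ →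
  R-form n a b u d ℚ.+ R-form n′ a′ b′ u′ d′ ≡ R-form (n + n′) (a + a′) (b + b′) (u + u′) (d + d′)
R-form-+ n a b u d n′ a′ b′ u′ d′ =
  trans (regroup (toℚ 6) (+ 3 / 2) (toℚ n) (toℚ a) (toℚ b) (toℚ u) (toℚ d)
                 (toℚ n′) (toℚ a′) (toℚ b′) (toℚ u′) (toℚ d′))
        (sym (R-formℚ-cong (toℚ-+ n n′) (toℚ-+ a a′) (toℚ-+ b b′) (toℚ-+ u u′) (toℚ-+ d d′)))
  where
  regroup : ∀ α β n a b u d n′ a′ b′ u′ d′ →
    (n ℚ.+ α ℚ.* a ℚ.+ β ℚ.* b ℚ.- u ℚ.- d) ℚ.+ (n′ ℚ.+ α ℚ.* a′ ℚ.+ β ℚ.* b′ ℚ.- u′ ℚ.- d′)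
    ≡ (n ℚ.+ n′) ℚ.+ α ℚ.* (a ℚ.+ a′) ℚ.+ β ℚ.* (b ℚ.+ b′) ℚ.- (u ℚ.+ u′) ℚ.- (d ℚ.+ d′)
  regroup = ℚ-Solver.solve-∀ ℚ-ring

R-form>0⇒ : ∀ {n a b u d} → 0ℚ ℚ.< R-form n a b u d → 2 * u + 2 * d < 2 * n + 12 * a + 3 * b
R-form>0⇒ {n} {a} {b} {u} {d} 0<R =
  toℚ-cancel-< (0<p-q⇒q<p (subst (0ℚ ℚ.<_) twice-R (ℚ.*-monoʳ-<-pos (toℚ 2) 0<R)))
  where
  double : ∀ γ α β n a b u d →
    γ ℚ.* (n ℚ.+ α ℚ.* a ℚ.+ β ℚ.* b ℚ.- u ℚ.- d)
    ≡ γ ℚ.* n ℚ.+ (γ ℚ.* α) ℚ.* a ℚ.+ (γ ℚ.* β) ℚ.* b ℚ.- (γ ℚ.* u ℚ.+ γ ℚ.* d)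
  double = ℚ-Solver.solve-∀ ℚ-ring
  twice-R : toℚ 2 ℚ.* R-form n a b u d ≡ toℚ (2 * n + 12 * a + 3 * b) ℚ.- toℚ (2 * u + 2 * d)
  twice-R = trans (double (toℚ 2) (toℚ 6) (+ 3 / 2) (toℚ n) (toℚ a) (toℚ b) (toℚ u) (toℚ d))
                  (sym (cong₂ ℚ._-_ (toℚ-linear₃ 2 n 12 a 3 b) (toℚ-linear₂ 2 u 2 d)))

coverage : ℚ → ℚ → ℚ
coverage x y = (x ℚ.+ y) ℚ.* (x ℚ.+ y) ℚ.- toℚ 6 ℚ.* x ℚ.- (+ 3 / 2) ℚ.* y ℚ.- 1ℚ

coverage≥0⇒ : ∀ {x y n f e} → x ℚ.* toℚ n ≡ toℚ f → y ℚ.* toℚ n ≡ toℚ e → 0ℚ ℚ.≤ coverage x y →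
  n * (2 * n + 12 * f + 3 * e) ≤ 2 * ((f + e) * (f + e))
coverage≥0⇒ {x} {y} {n} {f} {e} xν≡f yν≡e 0≤coverage =
  toℚ-cancel-≤ (0≤p-q⇒q≤p (subst (0ℚ ℚ.≤_) scaled 0≤coverage*c))
  where
  open ≡-Reasoning
  c ν : ℚ
  c = toℚ (2 * n * n)
  ν = toℚ n
  0≤coverage*c : 0ℚ ℚ.≤ coverage x y ℚ.* c
  0≤coverage*c = subst (ℚ._≤ coverage x y ℚ.* c) (ℚ.*-zeroˡ c)
                   (ℚ.*-monoʳ-≤-nonNeg c {{toℚ-nonNeg (2 * n * n)}} 0≤coverage)
  clear : ∀ γ α β x y ν →
    ((x ℚ.+ y) ℚ.* (x ℚ.+ y) ℚ.- α ℚ.* x ℚ.- β ℚ.* y ℚ.- 1ℚ) ℚ.* (γ ℚ.* ν ℚ.* ν)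
    ≡ γ ℚ.* ((x ℚ.* ν ℚ.+ y ℚ.* ν) ℚ.* (x ℚ.* ν ℚ.+ y ℚ.* ν))
      ℚ.- ν ℚ.* (γ ℚ.* ν ℚ.+ (γ ℚ.* α) ℚ.* (x ℚ.* ν) ℚ.+ (γ ℚ.* β) ℚ.* (y ℚ.* ν))
  clear = ℚ-Solver.solve-∀ ℚ-ring
  square : toℚ (2 * ((f + e) * (f + e))) ≡ toℚ 2 ℚ.* ((toℚ f ℚ.+ toℚ e) ℚ.* (toℚ f ℚ.+ toℚ e))
  square = trans (toℚ-* 2 ((f + e) * (f + e)))
                 (cong (toℚ 2 ℚ.*_) (trans (toℚ-* (f + e) (f + e)) (cong₂ ℚ._*_ (toℚ-+ f e) (toℚ-+ f e))))
  scaled : coverage x y ℚ.* c ≡ toℚ (2 * ((f + e) * (f + e))) ℚ.- toℚ (n * (2 * n + 12 * f + 3 * e))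
  scaled = begin
    coverage x y ℚ.* c
      ≡⟨ cong (coverage x y ℚ.*_) (trans (toℚ-* (2 * n) n) (cong (ℚ._* ν) (toℚ-* 2 n))) ⟩
    coverage x y ℚ.* (toℚ 2 ℚ.* ν ℚ.* ν)
      ≡⟨ clear (toℚ 2) (toℚ 6) (+ 3 / 2) x y ν ⟩
    toℚ 2 ℚ.* ((x ℚ.* ν ℚ.+ y ℚ.* ν) ℚ.* (x ℚ.* ν ℚ.+ y ℚ.* ν))
      ℚ.- ν ℚ.* (toℚ 2 ℚ.* ν ℚ.+ toℚ 12 ℚ.* (x ℚ.* ν) ℚ.+ toℚ 3 ℚ.* (y ℚ.* ν))
      ≡⟨ cong₂ (λ φ ε → toℚ 2 ℚ.* ((φ ℚ.+ ε) ℚ.* (φ ℚ.+ ε))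
                        ℚ.- ν ℚ.* (toℚ 2 ℚ.* ν ℚ.+ toℚ 12 ℚ.* φ ℚ.+ toℚ 3 ℚ.* ε)) xν≡f yν≡e ⟩
    toℚ 2 ℚ.* ((toℚ f ℚ.+ toℚ e) ℚ.* (toℚ f ℚ.+ toℚ e))
      ℚ.- ν ℚ.* (toℚ 2 ℚ.* ν ℚ.+ toℚ 12 ℚ.* toℚ f ℚ.+ toℚ 3 ℚ.* toℚ e)
      ≡⟨ cong₂ ℚ._-_ square (trans (toℚ-* n (2 * n + 12 * f + 3 * e))
                                    (cong (ν ℚ.*_) (toℚ-linear₃ 2 n 12 f 3 e))) ⟨
    toℚ (2 * ((f + e) * (f + e))) ℚ.- toℚ (n * (2 * n + 12 * f + 3 * e))
      ∎

module RankTwo (P : FinitePoset) (ρ : Elt P → ℕ) where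
  open WithRank P ρ

  ΣA₁ ΣB₁ ΣU₁ ΣD₁ : ℕ
  ΣA₁ = sum (map (A 1) (level 1))
  ΣB₁ = sum (map (B 1) (level 1))
  ΣU₁ = sum (map (U 1) (level 1))
  ΣD₁ = sum (map (D 1) (level 1))

  private
    covered-by? : ∀ y x → Dec (_⋖_ P x y)
    covered-by? y x = _⋖?_ P x y

  ΣA₁≡ΣB₂ : ΣA₁ ≡ sum (map (B 2) (level 2))
  ΣA₁≡ΣB₂ = sum-map-length-filter (_⋖?_ P) (level 1) (level 2)

  ΣB₁≡ΣA₀ : ΣB₁ ≡ sum (map (A 0) (level 0))
  ΣB₁≡ΣA₀ = sum-map-length-filter covered-by? (level 1) (level 0)

  ΣU₁≡ΣB₂² : ΣU₁ ≡ sum (map (λ y → B 2 y * B 2 y) (elts P))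
  ΣU₁≡ΣB₂² = sum-map-sum-filter (_⋖?_ P) (B 2) (level 1) (elts P)

  ΣD₁≡ΣA₀² : ΣD₁ ≡ sum (map (λ z → A 0 z * A 0 z) (elts P))
  ΣD₁≡ΣA₀² = sum-map-sum-filter covered-by? (A 0) (level 1) (elts P)

  [ΣA₁+ΣB₁]²≤ : (ΣA₁ + ΣB₁) * (ΣA₁ + ΣB₁) ≤ (p 2 + p 0) * (ΣU₁ + ΣD₁)
  [ΣA₁+ΣB₁]²≤ = begin
    (ΣA₁ + ΣB₁) * (ΣA₁ + ΣB₁)
      ≡⟨ cong (λ s → s * s) (trans (cong₂ _+_ ΣA₁≡ΣB₂ ΣB₁≡ΣA₀) (sym (sum-++ bs as))) ⟩
    sum (bs ++ as) * sum (bs ++ as)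
      ≤⟨ cauchy-schwarz (bs ++ as) ⟩
    length (bs ++ as) * sum (map square (bs ++ as))
      ≡⟨ cong₂ _*_ (trans (length-++ bs) (cong₂ _+_ (length-map (B 2) (level 2)) (length-map (A 0) (level 0))))
                   (trans (cong sum (map-++ square bs as)) (sum-++ (map square bs) (map square as))) ⟩
    (p 2 + p 0) * (sum (map square bs) + sum (map square as))
      ≡⟨ cong ((p 2 + p 0) *_) (sym (cong₂ _+_ (cong sum (map-∘ (level 2))) (cong sum (map-∘ (level 0))))) ⟩
    (p 2 + p 0) * (sum (map (λ y → B 2 y * B 2 y) (level 2)) + sum (map (λ z → A 0 z * A 0 z) (level 0)))
      ≤⟨ *-monoʳ-≤ (p 2 + p 0) (+-mono-≤ (sum-map-filter-≤ (λ x → ρ x ≟ 2) _ (elts P))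
                                          (sum-map-filter-≤ (λ x → ρ x ≟ 0) _ (elts P))) ⟩
    (p 2 + p 0) * (sum (map (λ y → B 2 y * B 2 y) (elts P)) + sum (map (λ z → A 0 z * A 0 z) (elts P)))
      ≡⟨ cong ((p 2 + p 0) *_) (sym (cong₂ _+_ ΣU₁≡ΣB₂² ΣD₁≡ΣA₀²)) ⟩
    (p 2 + p 0) * (ΣU₁ + ΣD₁)
      ∎
    where
    open ≤-Reasoning
    bs as : List ℕ
    bs = map (B 2) (level 2)
    as = map (A 0) (level 0)
    square : ℕ → ℕ
    square n = n * n

  avg₁*p₁ : ∀ f → avg₁ f ℚ.* toℚ (p 1) ≡ foldr ℚ._+_ 0ℚ (map f (level 1))
  avg₁*p₁ f with level 1
  ... | []     = refl
  ... | x ∷ xs = begin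
    Σf ℚ.* q ℚ.* ν   ≡⟨ ℚ.*-assoc Σf q ν ⟩
    Σf ℚ.* (q ℚ.* ν) ≡⟨ cong (Σf ℚ.*_) (1/[1+m]*toℚ[1+m]≡1 (length xs)) ⟩
    Σf ℚ.* 1ℚ        ≡⟨ ℚ.*-identityʳ Σf ⟩
    Σf               ∎
    where
    open ≡-Reasoning
    Σf q ν : ℚ
    Σf = foldr ℚ._+_ 0ℚ (map f (x ∷ xs))
    q  = + 1 / suc (length xs)
    ν  = toℚ (suc (length xs))

  avg₁-[] : ∀ f → level 1 ≡ [] → avg₁ f ≡ 0ℚ
  avg₁-[] f level₁≡[] rewrite level₁≡[] = refl

  p₁≢0 : 0ℚ <ℚ R̄₁ → NonZero (p 1)
  p₁≢0 0<R̄₁ = nonZero (level 1) refl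
    where
    nonZero : ∀ es → level 1 ≡ es → NonZero (length es)
    nonZero []      level₁≡[] = contradiction 0<R̄₁ (ℚ.<-irrefl (sym (avg₁-[] R₁ level₁≡[])))
    nonZero (_ ∷ _) _         = _

  sum-R₁ : ∀ es → foldr ℚ._+_ 0ℚ (map R₁ es) ≡
    R-form (length es) (sum (map (A 1) es)) (sum (map (B 1) es)) (sum (map (U 1) es)) (sum (map (D 1) es))
  sum-R₁ []       = refl
  sum-R₁ (e ∷ es) = trans (cong (R₁ e ℚ.+_) (sum-R₁ es)) (R-form-+ 1 (A 1 e) (B 1 e) (U 1 e) (D 1 e)
    (length es) (sum (map (A 1) es)) (sum (map (B 1) es)) (sum (map (U 1) es)) (sum (map (D 1) es)))

  R̄₁>0⇒ : 0ℚ <ℚ R̄₁ → 2 * ΣU₁ + 2 * ΣD₁ < 2 * p 1 + 12 * ΣA₁ + 3 * ΣB₁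
  R̄₁>0⇒ 0<R̄₁ = R-form>0⇒ {p 1} {ΣA₁} {ΣB₁} {ΣU₁} {ΣD₁}
    (subst (0ℚ <ℚ_) (trans (avg₁*p₁ R₁) (sum-R₁ (level 1))) 0<R̄₁*p₁)
    where
    0<R̄₁*p₁ : 0ℚ <ℚ R̄₁ ℚ.* toℚ (p 1)
    0<R̄₁*p₁ = subst (_<ℚ R̄₁ ℚ.* toℚ (p 1)) (ℚ.*-zeroˡ (toℚ (p 1)))
                (ℚ.*-monoˡ-<-pos (toℚ (p 1)) {{toℚ-pos (p 1) {{p₁≢0 0<R̄₁}}}} 0<R̄₁)

  sufficientlyCovered⇒ : SufficientlyCovered →
    p 1 * (2 * p 1 + 12 * ΣA₁ + 3 * ΣB₁) ≤ 2 * ((ΣA₁ + ΣB₁) * (ΣA₁ + ΣB₁))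
  sufficientlyCovered⇒ = coverage≥0⇒ {Ā₁} {B̄₁} {p 1} {ΣA₁} {ΣB₁}
    (trans (avg₁*p₁ _) (toℚ-sum (A 1) (level 1))) (trans (avg₁*p₁ _) (toℚ-sum (B 1) (level 1)))

  χgr₂≡ : χgr 2 ≡ (p 2 + p 0) ⊖ p 1
  χgr₂≡ = begin
    χgr 2
      ≡⟨ cong₂ ℤ._+_ (ℤ.*-identityˡ (+ p 0))
                     (cong₂ ℤ._+_ (ℤ.-1*i≡-i (+ p 1)) (trans (ℤ.+-identityʳ _) (ℤ.*-identityˡ (+ p 2)))) ⟩
    + p 0 ℤ.+ (ℤ.- (+ p 1) ℤ.+ + p 2)  ≡⟨ cong (ℤ._+_ (+ p 0)) (ℤ.-m+n≡n⊖m (p 1) (p 2)) ⟩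
    + p 0 ℤ.+ (p 2 ⊖ p 1)              ≡⟨ ℤ.distribʳ-⊖-+-pos (p 0) (p 2) (p 1) ⟩
    (p 0 + p 2) ⊖ p 1                  ≡⟨ cong (_⊖ p 1) (+-comm (p 0) (p 2)) ⟩
    (p 2 + p 0) ⊖ p 1                  ∎
    where open ≡-Reasoning

theorem2p7 : (P : FinitePoset) → HasRank P 2 →
    (ρ : Elt P → ℕ) → IsRankFunction P ρ 2 →
    WithRank.SufficientlyCovered P ρ →
    0ℚ <ℚ WithRank.R̄₁ P ρ →
    + 0 <ℤ WithRank.χgr P ρ 2
theorem2p7 P _ ρ _ covered 0<R̄₁ = subst (+ 0 <ℤ_) (sym χgr₂≡) (n<m⇒0<m⊖n p₁<p₂+p₀)
  where
  open WithRank P ρ using (p)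
  open RankTwo P ρ
  p₁<p₂+p₀ : p 1 < p 2 + p 0
  p₁<p₂+p₀ = <-of-covering-bounds (p 1) {ΣA₁} {ΣB₁} {ΣU₁} {ΣD₁} {{p₁≢0 0<R̄₁}}
               (R̄₁>0⇒ 0<R̄₁) (sufficientlyCovered⇒ covered) [ΣA₁+ΣB₁]²≤
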